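{- Let $(U,\mathcal{D},G^*)$ be a standard configuration, let $D,E\in\mathcal{D}$, let $(S,B)$ be a primitive pair for $\Lambda^*(D)$, let $C$ be a block of $\Lambda^*(E)$ with $C\blacktriangleright^B S$, and let $T$ be a block of $\Lambda^*(E)$ such that $(C,T)$ is a primitive pair for $\Lambda^*(E)$. Then $T\blacktriangleright^B S$ or $S\blacktriangleright^T C$.
   Context: A standard configuration $(U,\mathcal{D},G^*)$: $U$ is a finite ordered set containing no nontrivial order-autonomous antichain (a nonempty $A\subseteq U$ is order-autonomous iff for every $z\notin A$, $z<a$ for some $a\in A$ implies $z<A$, and $z>a$ for some $a\in A$ implies $z>A$; nontrivial means $|A|\notin\{1,|U|\}$), $G^*$ is a subgroup of ${\rm Aut}(U)$, $\mathcal{D}$ is the set of $G^*$-orbits. For $D\in\mathcal{D}$, $\Lambda^*(D)=\{\Phi|_D:\Phi\in G^*\}$; a block of $\Lambda^*(D)$ is $B\subseteq D$ with $\sigma[B]=B$ or $\sigma[B]\cap B=\emptyset$ for all $\sigma\in\Lambda^*(D)$; $\Lambda^*(D)\cdot B=\{\Phi[B]:\Phi\in G^*\}$. For blocks $S\subsetneq B$ of $\Lambda^*(D)$, $B[\Lambda^*(D)\cdot S]=\{S'\in\Lambda^*(D)\cdot S:S'\subseteq B\}$, and $(S,B)$ is a primitive pair iff $\{\Phi^{\Lambda^*(D)\cdot S}|_{B[\Lambda^*(D)\cdot S]}:\Phi\in G^*,\Phi[B]\subseteq B\}$ (where $\Phi^{\Lambda^*(D)\cdot S}$ is $X\mapsto\Phi[X]$)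 is a primitive permutation group on $B[\Lambda^*(D)\cdot S]$. Weaving type of a pair $(X,Y)$ of blocks (each a $G^*$-conjugate of a fixed block): "made" if $X<Y$ or $X>Y$ elementwise strictly; "incomparable" if no element of $X$ is comparable to an element of $Y$; otherwise nontrivially woven, with type the class $\{(\Phi[X],\Phi[Y]):\Phi\in G^*\}$. Control: for a primitive pair $(S,B)$ of $\Lambda^*(D)$ and a block $X$ of $\Lambda^*(E)$, $X\blacktriangleright^B S$ iff the pairs $(X,S')$, $S'\in B[\Lambda^*(D)\cdot S]$, do not all have the same weaving type. -}

module Defs where

open import Level using (0ℓ)
open import Data.Nat using (ℕ)
open import Data.Fin using (Fin)
open import Data.Fin.Subset using (Subset; _∈_; _∉_; _⊆_; _∩_; ∣_∣; Nonempty; Empty)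
open import Data.Vec using (tabulate; lookup)
open import Data.Product using (Σ; ∃; ∃-syntax; _×_; _,_)
open import Data.Sum using (_⊎_)
open import Relation.Nullary using (¬_)
open import Relation.Binary using (Rel; IsStrictPartialOrder)
open import Relation.Binary.PropositionalEquality using (_≡_; _≢_)

-- A finite ordered set U is Fin n with a strict partial order _<_.
-- Subsets of U are Data.Fin.Subset (Vec Bool n), so equality of sets is _≡_.

module Order {n : ℕ} (_<_ : Rel (Fin n) 0ℓ) where

  _<ˢ_ : Fin n → Subset n → Set
  z <ˢ A = ∀ a → a ∈ A → z < a

  _>ˢ_ : Fin n → Subset n → Set
  z >ˢ A = ∀ a → a ∈ A → a < z

  OrderAutonomous : Subset n → Set
  OrderAutonomous A =
    Nonempty A ×
    (∀ z → z ∉ A →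
       ((∃[ a ] (a ∈ A × z < a)) → z <ˢ A) ×
       ((∃[ a ] (a ∈ A × a < z)) → z >ˢ A))

  Antichain : Subset n → Set
  Antichain A = ∀ a b → a ∈ A → b ∈ A → ¬ (a < b)

  NoNontrivialAutonomousAntichain : Set
  NoNontrivialAutonomousAntichain =
    ∀ A → OrderAutonomous A → Antichain A → (∣ A ∣ ≡ 1) ⊎ (∣ A ∣ ≡ n)

  record Aut : Set where
    field
      fun     : Fin n → Fin n
      inv     : Fin n → Fin n
      inv-l   : ∀ x → inv (fun x) ≡ x
      inv-r   : ∀ y → fun (inv y) ≡ y
      mono    : ∀ x y → x < y → fun x < fun y
      reflect : ∀ x y → fun x < fun y → x < y
  open Aut public

  idAut : Aut
  idAut = record { fun = λ x → x ; inv = λ x → x ; inv-l = λ _ → _≡_.refl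
                 ; inv-r = λ _ → _≡_.refl ; mono = λ _ _ p → p ; reflect = λ _ _ p → p }

  _∘A_ : Aut → Aut → Aut
  Φ ∘A Ψ = record
    { fun = λ x → fun Φ (fun Ψ x)
    ; inv = λ y → inv Ψ (inv Φ y)
    ; inv-l = λ x → trans' (cong' (inv Ψ) (inv-l Φ (fun Ψ x))) (inv-l Ψ x)
    ; inv-r = λ y → trans' (cong' (fun Φ) (inv-r Ψ (inv Φ y))) (inv-r Φ y)
    ; mono = λ x y p → mono Φ _ _ (mono Ψ x y p)
    ; reflect = λ x y p → reflect Ψ x y (reflect Φ _ _ p) }
    where
    open import Relation.Binary.PropositionalEquality
      renaming (trans to trans'; cong to cong')

  invAut : Aut → Aut
  invAut Φ = record
    { fun = inv Φ ; inv = fun Φ ; inv-l = inv-r Φ ; inv-r = inv-l Φ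
    ; mono = λ x y p → reflect Φ _ _ (subst2 _<_ (sym (inv-r Φ x)) (sym (inv-r Φ y)) p)
    ; reflect = λ x y p → subst2 _<_ (inv-r Φ x) (inv-r Φ y) (mono Φ _ _ p) }
    where
    open import Relation.Binary.PropositionalEquality using (sym)
      renaming (subst₂ to subst2)

  record Subgroup : Set₁ where
    field
      In      : Aut → Set
      ext     : ∀ Φ Ψ → (∀ x → fun Φ x ≡ fun Ψ x) → In Φ → In Ψ
      id-in   : In idAut
      comp-in : ∀ Φ Ψ → In Φ → In Ψ → In (Φ ∘A Ψ)
      inv-in  : ∀ Φ → In Φ → In (invAut Φ)

  -- Φ[A] = { Φ x | x ∈ A } ; y ∈ Φ[A] iff Φ⁻¹ y ∈ A
  img : Aut → Subset n → Subset n
  img Φ A = tabulate (λ y → lookup A (inv Φ y))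

module Config {n : ℕ} (_<_ : Rel (Fin n) 0ℓ) (G : Order.Subgroup _<_) where
  open Order _<_
  open Subgroup G

  IsOrbit : Subset n → Set
  IsOrbit D = ∃[ x ] (∀ y → (y ∈ D → ∃[ Φ ] (In Φ × fun Φ x ≡ y))
                          × (∃[ Φ ] (In Φ × fun Φ x ≡ y) → y ∈ D))

  -- B is a block of Λ*(D)  (σ = Φ|_D, and σ[B] = Φ[B] as B ⊆ D)
  IsBlock : Subset n → Subset n → Set
  IsBlock D B = B ⊆ D × (∀ Φ → In Φ → (img Φ B ≡ B) ⊎ Empty (img Φ B ∩ B))

  InOrbitOf : Subset n → Subset n → Set
  InOrbitOf S S' = ∃[ Φ ] (In Φ × img Φ S ≡ S')

  InB : Subset n → Subset n → Subset n → Set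
  InB B S S' = InOrbitOf S S' × S' ⊆ B

  -- the group { Φ^{Λ*(D)·S} restricted to B[Λ*(D)·S] : Φ ∈ G*, Φ[B] ⊆ B },
  -- acting on B[Λ*(D)·S] by X ↦ Φ[X]
  InH : Subset n → Aut → Set
  InH B Φ = In Φ × img Φ B ⊆ B

  Transitive : Subset n → Subset n → Set
  Transitive B S = ∀ Z W → InB B S Z → InB B S W → ∃[ Φ ] (InH B Φ × img Φ Z ≡ W)

  IsBlockH : Subset n → (Subset n → Set) → Set
  IsBlockH B Y = ∀ Φ → InH B Φ →
    ((∀ W → (∃[ Z ] (Y Z × img Φ Z ≡ W)) → Y W) × (∀ W → Y W → ∃[ Z ] (Y Z × img Φ Z ≡ W)))
    ⊎ (∀ Z → Y Z → ¬ Y (img Φ Z))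

  TrivialBlock : Subset n → Subset n → (Subset n → Set) → Set
  TrivialBlock B S Y =
    (∀ Z → ¬ Y Z) ⊎ (∃[ Z ] (Y Z × (∀ W → Y W → W ≡ Z))) ⊎ (∀ Z → InB B S Z → Y Z)

  Primitive : Subset n → Subset n → Set₁
  Primitive B S = Transitive B S ×
    (∀ (Y : Subset n → Set) → (∀ Z → Y Z → InB B S Z) → IsBlockH B Y → TrivialBlock B S Y)

  PrimitivePair : Subset n → Subset n → Subset n → Set₁
  PrimitivePair D S B = IsBlock D S × IsBlock D B × S ⊆ B × S ≢ B × Primitive B S

  Made : Subset n → Subset n → Set
  Made X Y = (∀ x y → x ∈ X → y ∈ Y → x < y) ⊎ (∀ x y → x ∈ X → y ∈ Y → y < x)

  Incomparable : Subset n → Subset n → Set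
  Incomparable X Y = ∀ x y → x ∈ X → y ∈ Y → ¬ (x < y) × ¬ (y < x)

  NontriviallyWoven : Subset n → Subset n → Set
  NontriviallyWoven X Y = ¬ Made X Y × ¬ Incomparable X Y

  SameWeavingType : Subset n → Subset n → Subset n → Subset n → Set
  SameWeavingType X Y X' Y' =
    (Made X Y × Made X' Y')
    ⊎ (Incomparable X Y × Incomparable X' Y')
    ⊎ (NontriviallyWoven X Y × NontriviallyWoven X' Y'
        × ∃[ Φ ] (In Φ × img Φ X ≡ X' × img Φ Y ≡ Y'))

  -- X ▶^B S : the pairs (X,S'), S' ∈ B[Λ*(D)·S], do not all have the same weaving type
  Controls : Subset n → Subset n → Subset n → Set
  Controls X B S = ¬ (∀ S₁ S₂ → InB B S S₁ → InB B S S₂ → SameWeavingType X S₁ X S₂)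

{-# OPTIONS --safe #-}
-- Either T ▶^B S, and we are done, or all pairs (T, S'), S' ∈ B[Λ*(D)·S],
-- share one weaving type.  In the latter case, if also all pairs (S, C'),
-- C' ∈ T[Λ*(E)·C], shared one weaving type, then so would all pairs (C, S'):
-- made and incomparable pairs (T, S') restrict to C ⊆ T, and when (T, S) and
-- (T, S') are nontrivially woven, an automorphism Φ with Φ[T] = T and
-- Φ[S] = S' carries (S, Φ⁻¹[C]) to (S', C), whose type is that of (S, C).
-- This contradicts C ▶^B S.
module Submission where

open import Defs
open import Axiom.ExcludedMiddle using (ExcludedMiddle)
open import Level using (0ℓ)
open import Data.Nat using (ℕ)
open import Data.Fin using (Fin)
open import Data.Fin.Subset using (Subset; _∈_; _⊆_; Nonempty; Empty)
open import Data.Fin.Subset.Properties using (nonempty?; x∈p∩q⁺)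
open import Data.Vec using (tabulate; lookup)
open import Data.Vec.Properties using (lookup⇒[]=; []=⇒lookup; lookup∘tabulate; tabulate∘lookup; tabulate-cong)
open import Data.Product using (∃-syntax; _×_; _,_; proj₁; proj₂)
open import Data.Sum using (_⊎_; inj₁; inj₂)
open import Data.Empty using (⊥-elim)
open import Relation.Nullary using (¬_; Dec; yes; no)
open import Relation.Binary using (Rel; IsStrictPartialOrder)
open import Relation.Binary.PropositionalEquality using (_≡_; refl; sym; trans; cong; subst; subst₂)

module ImageProperties {n : ℕ} (_<_ : Rel (Fin n) 0ℓ) where
  open Order _<_

  ∈-img⁻ : ∀ Φ A {x} → x ∈ img Φ A → inv Φ x ∈ A
  ∈-img⁻ Φ A {x} x∈ΦA =
    lookup⇒[]= _ A (trans (sym (lookup∘tabulate (λ y → lookup A (inv Φ y)) x)) ([]=⇒lookup x∈ΦA))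

  ∈-img⁺ : ∀ Φ A {x} → inv Φ x ∈ A → x ∈ img Φ A
  ∈-img⁺ Φ A {x} Φ⁻¹x∈A =
    lookup⇒[]= x (img Φ A) (trans (lookup∘tabulate (λ y → lookup A (inv Φ y)) x) ([]=⇒lookup Φ⁻¹x∈A))

  fun∈img : ∀ Φ A {x} → x ∈ A → fun Φ x ∈ img Φ A
  fun∈img Φ A {x} x∈A = ∈-img⁺ Φ A (subst (_∈ A) (sym (inv-l Φ x)) x∈A)

  img-⊆ : ∀ Φ {A A'} → A ⊆ A' → img Φ A ⊆ img Φ A'
  img-⊆ Φ {A} {A'} A⊆A' x∈ΦA = ∈-img⁺ Φ A' (A⊆A' (∈-img⁻ Φ A x∈ΦA))

  img-empty : ∀ Φ {A} → Empty A → Empty (img Φ A)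
  img-empty Φ {A} A-empty (x , x∈ΦA) = A-empty (inv Φ x , ∈-img⁻ Φ A x∈ΦA)

  img-∘A : ∀ Φ Ψ A → img Φ (img Ψ A) ≡ img (Φ ∘A Ψ) A
  img-∘A Φ Ψ A = tabulate-cong (λ y → lookup∘tabulate (λ z → lookup A (inv Ψ z)) (inv Φ y))

  img-identity : ∀ Φ A → (∀ y → inv Φ y ≡ y) → img Φ A ≡ A
  img-identity Φ A inv≗id = trans (tabulate-cong (λ y → cong (lookup A) (inv≗id y))) (tabulate∘lookup A)

  img-invAut-img : ∀ Φ A → img (invAut Φ) (img Φ A) ≡ A
  img-invAut-img Φ A = trans (img-∘A (invAut Φ) Φ A) (img-identity (invAut Φ ∘A Φ) A (inv-l Φ))

  img-img-invAut : ∀ Φ A → img Φ (img (invAut Φ) A) ≡ A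
  img-img-invAut Φ A = trans (img-∘A Φ (invAut Φ) A) (img-identity (Φ ∘A invAut Φ) A (inv-r Φ))

  img-invAut-fixed : ∀ Φ {A} → img Φ A ≡ A → img (invAut Φ) A ≡ A
  img-invAut-fixed Φ {A} ΦA≡A = trans (cong (img (invAut Φ)) (sym ΦA≡A)) (img-invAut-img Φ A)

module Weaving {n : ℕ} (_<_ : Rel (Fin n) 0ℓ) (G : Order.Subgroup _<_) where
  open Order _<_
  open Config _<_ G
  open Subgroup G
  open ImageProperties _<_

  UniformlyWoven : Subset n → Subset n → Subset n → Set
  UniformlyWoven X B S = ∀ S₁ S₂ → InB B S S₁ → InB B S S₂ → SameWeavingType X S₁ X S₂

  Made-img : ∀ Φ {X Y} → Made X Y → Made (img Φ X) (img Φ Y)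
  Made-img Φ {X} {Y} (inj₁ X<Y) = inj₁ λ x y x∈ y∈ →
    reflect (invAut Φ) x y (X<Y _ _ (∈-img⁻ Φ X x∈) (∈-img⁻ Φ Y y∈))
  Made-img Φ {X} {Y} (inj₂ Y<X) = inj₂ λ x y x∈ y∈ →
    reflect (invAut Φ) y x (Y<X _ _ (∈-img⁻ Φ X x∈) (∈-img⁻ Φ Y y∈))

  Incomparable-img : ∀ Φ {X Y} → Incomparable X Y → Incomparable (img Φ X) (img Φ Y)
  Incomparable-img Φ {X} {Y} X∥Y x y x∈ y∈ =
    (λ x<y → proj₁ (X∥Y _ _ (∈-img⁻ Φ X x∈) (∈-img⁻ Φ Y y∈)) (mono (invAut Φ) x y x<y)) ,
    (λ y<x → proj₂ (X∥Y _ _ (∈-img⁻ Φ X x∈) (∈-img⁻ Φ Y y∈)) (mono (invAut Φ) y x y<x))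

  NontriviallyWoven-img : ∀ Φ {X Y} → NontriviallyWoven X Y → NontriviallyWoven (img Φ X) (img Φ Y)
  NontriviallyWoven-img Φ {X} {Y} (¬made , ¬incomparable) =
    (λ made → ¬made (subst₂ Made (img-invAut-img Φ X) (img-invAut-img Φ Y) (Made-img (invAut Φ) made))) ,
    (λ inc → ¬incomparable
      (subst₂ Incomparable (img-invAut-img Φ X) (img-invAut-img Φ Y) (Incomparable-img (invAut Φ) inc)))

  Made-swap : ∀ {X Y} → Made X Y → Made Y X
  Made-swap (inj₁ X<Y) = inj₂ λ y x y∈ x∈ → X<Y x y x∈ y∈
  Made-swap (inj₂ Y<X) = inj₁ λ y x y∈ x∈ → Y<X x y x∈ y∈

  Incomparable-swap : ∀ {X Y} → Incomparable X Y → Incomparable Y X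
  Incomparable-swap X∥Y y x y∈ x∈ = proj₂ (X∥Y x y x∈ y∈) , proj₁ (X∥Y x y x∈ y∈)

  NontriviallyWoven-swap : ∀ {X Y} → NontriviallyWoven X Y → NontriviallyWoven Y X
  NontriviallyWoven-swap (¬made , ¬incomparable) =
    (λ made → ¬made (Made-swap made)) , (λ inc → ¬incomparable (Incomparable-swap inc))

  Made-⊆ˡ : ∀ {X X' Y} → X ⊆ X' → Made X' Y → Made X Y
  Made-⊆ˡ X⊆X' (inj₁ X'<Y) = inj₁ λ x y x∈ y∈ → X'<Y x y (X⊆X' x∈) y∈
  Made-⊆ˡ X⊆X' (inj₂ Y<X') = inj₂ λ x y x∈ y∈ → Y<X' x y (X⊆X' x∈) y∈

  Incomparable-⊆ˡ : ∀ {X X' Y} → X ⊆ X' → Incomparable X' Y → Incomparable X Y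
  Incomparable-⊆ˡ X⊆X' X'∥Y x y x∈ y∈ = X'∥Y x y (X⊆X' x∈) y∈

  Made-emptyˡ : ∀ {X Y} → Empty X → Made X Y
  Made-emptyˡ X-empty = inj₁ λ x _ x∈ _ → ⊥-elim (X-empty (x , x∈))

  Made-emptyʳ : ∀ {X Y} → Empty Y → Made X Y
  Made-emptyʳ Y-empty = inj₁ λ _ y _ y∈ → ⊥-elim (Y-empty (y , y∈))

  Made⇒¬Incomparable : ∀ {X Y} → Nonempty X → Nonempty Y → Made X Y → ¬ Incomparable X Y
  Made⇒¬Incomparable (x , x∈) (y , y∈) (inj₁ X<Y) X∥Y = proj₁ (X∥Y x y x∈ y∈) (X<Y x y x∈ y∈)
  Made⇒¬Incomparable (x , x∈) (y , y∈) (inj₂ Y<X) X∥Y = proj₂ (X∥Y x y x∈ y∈) (Y<X x y x∈ y∈)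

  SameWeavingType-sym : ∀ {X Y X' Y'} → SameWeavingType X Y X' Y' → SameWeavingType X' Y' X Y
  SameWeavingType-sym (inj₁ (made , made')) = inj₁ (made' , made)
  SameWeavingType-sym (inj₂ (inj₁ (inc , inc'))) = inj₂ (inj₁ (inc' , inc))
  SameWeavingType-sym {X} {Y} (inj₂ (inj₂ (nw , nw' , Φ , Φ∈G , ΦX≡X' , ΦY≡Y'))) =
    inj₂ (inj₂ (nw' , nw , invAut Φ , inv-in Φ Φ∈G ,
      trans (cong (img (invAut Φ)) (sym ΦX≡X')) (img-invAut-img Φ X) ,
      trans (cong (img (invAut Φ)) (sym ΦY≡Y')) (img-invAut-img Φ Y)))

  -- An empty side would make a pair both made and incomparable, whence the
  -- nonemptiness of the middle pair.
  SameWeavingType-trans : ∀ {X Y X' Y' X'' Y''} → Nonempty X' → Nonempty Y' →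
    SameWeavingType X Y X' Y' → SameWeavingType X' Y' X'' Y'' → SameWeavingType X Y X'' Y''
  SameWeavingType-trans _ _ (inj₁ (made , _)) (inj₁ (_ , made'')) = inj₁ (made , made'')
  SameWeavingType-trans X'≠∅ Y'≠∅ (inj₁ (_ , made')) (inj₂ (inj₁ (inc' , _))) =
    ⊥-elim (Made⇒¬Incomparable X'≠∅ Y'≠∅ made' inc')
  SameWeavingType-trans _ _ (inj₁ (_ , made')) (inj₂ (inj₂ ((¬made' , _) , _))) = ⊥-elim (¬made' made')
  SameWeavingType-trans X'≠∅ Y'≠∅ (inj₂ (inj₁ (_ , inc'))) (inj₁ (made' , _)) =
    ⊥-elim (Made⇒¬Incomparable X'≠∅ Y'≠∅ made' inc')
  SameWeavingType-trans _ _ (inj₂ (inj₁ (inc , _))) (inj₂ (inj₁ (_ , inc''))) = inj₂ (inj₁ (inc , inc''))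
  SameWeavingType-trans _ _ (inj₂ (inj₁ (_ , inc'))) (inj₂ (inj₂ ((_ , ¬inc') , _))) = ⊥-elim (¬inc' inc')
  SameWeavingType-trans _ _ (inj₂ (inj₂ (_ , (¬made' , _) , _))) (inj₁ (made' , _)) = ⊥-elim (¬made' made')
  SameWeavingType-trans _ _ (inj₂ (inj₂ (_ , (_ , ¬inc') , _))) (inj₂ (inj₁ (inc' , _))) = ⊥-elim (¬inc' inc')
  SameWeavingType-trans {X} {Y} _ _
    (inj₂ (inj₂ (nw , _ , Φ , Φ∈G , ΦX≡X' , ΦY≡Y')))
    (inj₂ (inj₂ (_ , nw'' , Ψ , Ψ∈G , ΨX'≡X'' , ΨY'≡Y''))) =
    inj₂ (inj₂ (nw , nw'' , Ψ ∘A Φ , comp-in Ψ Φ Ψ∈G Φ∈G ,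
      trans (sym (img-∘A Ψ Φ X)) (trans (cong (img Ψ) ΦX≡X') ΨX'≡X'') ,
      trans (sym (img-∘A Ψ Φ Y)) (trans (cong (img Ψ) ΦY≡Y') ΨY'≡Y'')))

  SameWeavingType-swap : ∀ {X Y X' Y'} → SameWeavingType X Y X' Y' → SameWeavingType Y X Y' X'
  SameWeavingType-swap (inj₁ (made , made')) = inj₁ (Made-swap made , Made-swap made')
  SameWeavingType-swap (inj₂ (inj₁ (inc , inc'))) = inj₂ (inj₁ (Incomparable-swap inc , Incomparable-swap inc'))
  SameWeavingType-swap (inj₂ (inj₂ (nw , nw' , Φ , Φ∈G , ΦX≡X' , ΦY≡Y'))) =
    inj₂ (inj₂ (NontriviallyWoven-swap nw , NontriviallyWoven-swap nw' , Φ , Φ∈G , ΦY≡Y' , ΦX≡X'))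

  SameWeavingType-imgʳ : ∀ Φ {X Y X' Y'} → In Φ →
    SameWeavingType X Y X' Y' → SameWeavingType X Y (img Φ X') (img Φ Y')
  SameWeavingType-imgʳ Φ _ (inj₁ (made , made')) = inj₁ (made , Made-img Φ made')
  SameWeavingType-imgʳ Φ _ (inj₂ (inj₁ (inc , inc'))) = inj₂ (inj₁ (inc , Incomparable-img Φ inc'))
  SameWeavingType-imgʳ Φ {X} {Y} Φ∈G (inj₂ (inj₂ (nw , nw' , Ψ , Ψ∈G , ΨX≡X' , ΨY≡Y'))) =
    inj₂ (inj₂ (nw , NontriviallyWoven-img Φ nw' , Φ ∘A Ψ , comp-in Φ Ψ Φ∈G Ψ∈G ,
      trans (sym (img-∘A Φ Ψ X)) (cong (img Φ) ΨX≡X') ,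
      trans (sym (img-∘A Φ Ψ Y)) (cong (img Φ) ΨY≡Y')))

  InB-self : ∀ {B S} → S ⊆ B → InB B S S
  InB-self {S = S} S⊆B = (idAut , id-in , img-identity idAut S (λ _ → refl)) , S⊆B

  InB-img : ∀ Φ {B S Z} → In Φ → img Φ B ≡ B → InB B S Z → InB B S (img Φ Z)
  InB-img Φ {B} {S} Φ∈G ΦB≡B ((Ψ , Ψ∈G , ΨS≡Z) , Z⊆B) =
    (Φ ∘A Ψ , comp-in Φ Ψ Φ∈G Ψ∈G , trans (sym (img-∘A Φ Ψ S)) (cong (img Φ) ΨS≡Z)) ,
    (λ x∈ΦZ → subst (_ ∈_) ΦB≡B (img-⊆ Φ Z⊆B x∈ΦZ))

  uniformlyWoven-emptyˡ : ∀ {X B S} → Empty X → UniformlyWoven X B S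
  uniformlyWoven-emptyˡ X-empty _ _ _ _ = inj₁ (Made-emptyˡ X-empty , Made-emptyˡ X-empty)

  uniformlyWoven-emptyʳ : ∀ {X B S} → Empty S → UniformlyWoven X B S
  uniformlyWoven-emptyʳ {S = S} S-empty S₁ S₂ ((Φ₁ , _ , Φ₁S≡S₁) , _) ((Φ₂ , _ , Φ₂S≡S₂) , _) =
    inj₁ (Made-emptyʳ (subst Empty Φ₁S≡S₁ (img-empty Φ₁ S-empty)) ,
          Made-emptyʳ (subst Empty Φ₂S≡S₂ (img-empty Φ₂ S-empty)))

  -- In this encoding blocks of the induced group are arbitrary predicates, so
  -- primitivity applies to { Z ∈ B[Λ*(D)·S] | P }: that block is trivial
  -- exactly when P holds or fails.  This supplies the classical case split.
  primitive⇒excludedMiddle : ∀ {D S B} → IsBlock D B → S ⊆ B → Nonempty S → Primitive B S →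
    ExcludedMiddle 0ℓ
  primitive⇒excludedMiddle {S = S} {B} (_ , B-block) S⊆B (s , s∈S) (_ , onlyTrivial) {P}
    with onlyTrivial (λ Z → InB B S Z × P) (λ _ → proj₁) P-block
    where
    fixesB : ∀ Φ → InH B Φ → img Φ B ≡ B
    fixesB Φ (Φ∈G , ΦB⊆B) with B-block Φ Φ∈G
    ... | inj₁ ΦB≡B = ΦB≡B
    ... | inj₂ disjoint = ⊥-elim (disjoint (fun Φ s , x∈p∩q⁺ (Φs∈ΦB , ΦB⊆B Φs∈ΦB)))
      where Φs∈ΦB = fun∈img Φ B (S⊆B s∈S)

    P-block : IsBlockH B (λ Z → InB B S Z × P)
    P-block Φ Φ∈H@(Φ∈G , _) = inj₁ (image-closed , preimage-closed)
      where
      image-closed : ∀ W → (∃[ Z ] ((InB B S Z × P) × img Φ Z ≡ W)) → InB B S W × P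
      image-closed W (Z , (Z∈ , p) , ΦZ≡W) = subst (InB B S) ΦZ≡W (InB-img Φ {S = S} Φ∈G (fixesB Φ Φ∈H) Z∈) , p

      preimage-closed : ∀ W → InB B S W × P → ∃[ Z ] ((InB B S Z × P) × img Φ Z ≡ W)
      preimage-closed W (W∈ , p) =
        img (invAut Φ) W ,
        (InB-img (invAut Φ) {S = S} (inv-in Φ Φ∈G) (img-invAut-fixed Φ (fixesB Φ Φ∈H)) W∈ , p) ,
        img-img-invAut Φ W
  ... | inj₁ noneHolds = no λ p → noneHolds S (InB-self S⊆B , p)
  ... | inj₂ (inj₁ (_ , (_ , p) , _)) = yes p
  ... | inj₂ (inj₂ allHold) = yes (proj₂ (allHold S (InB-self S⊆B)))

  sameWeavingType-restrict : ∀ {B S T C S'} → C ⊆ T → S ⊆ B →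
    UniformlyWoven T B S → UniformlyWoven S T C → InB B S S' → SameWeavingType C S C S'
  sameWeavingType-restrict {S = S} {T} {C} {S'} C⊆T S⊆B T-uniform S-uniform S'∈
    with T-uniform S S' (InB-self S⊆B) S'∈
  ... | inj₁ (made , made') = inj₁ (Made-⊆ˡ C⊆T made , Made-⊆ˡ C⊆T made')
  ... | inj₂ (inj₁ (inc , inc')) = inj₂ (inj₁ (Incomparable-⊆ˡ C⊆T inc , Incomparable-⊆ˡ C⊆T inc'))
  ... | inj₂ (inj₂ (_ , _ , Φ , Φ∈G , ΦT≡T , ΦS≡S')) =
    SameWeavingType-swap (subst₂ (SameWeavingType S C) ΦS≡S' (img-img-invAut Φ C)
      (SameWeavingType-imgʳ Φ Φ∈G (S-uniform C (img (invAut Φ) C) (InB-self C⊆T) Φ⁻¹C∈)))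
    where
    Φ⁻¹C∈ : InB T C (img (invAut Φ) C)
    Φ⁻¹C∈ = InB-img (invAut Φ) {S = C} (inv-in Φ Φ∈G) (img-invAut-fixed Φ ΦT≡T) (InB-self C⊆T)

  uniformlyWoven-restrict : ∀ {B S T C} → Nonempty C → Nonempty S → C ⊆ T → S ⊆ B →
    UniformlyWoven T B S → UniformlyWoven S T C → UniformlyWoven C B S
  uniformlyWoven-restrict {B} {S} {C = C} C≠∅ S≠∅ C⊆T S⊆B T-uniform S-uniform S₁ S₂ S₁∈ S₂∈ =
    SameWeavingType-trans C≠∅ S≠∅ (SameWeavingType-sym (like-S S₁∈)) (like-S S₂∈)
    where
    like-S : ∀ {S'} → InB B S S' → SameWeavingType C S C S'
    like-S = sameWeavingType-restrict C⊆T S⊆B T-uniform S-uniform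

lemma5p12 : {n : ℕ} (_<_ : Rel (Fin n) 0ℓ) → IsStrictPartialOrder _≡_ _<_ →
    Order.NoNontrivialAutonomousAntichain _<_ →
    (G : Order.Subgroup _<_) →
    (D E S B C T : Subset n) →
    Config.IsOrbit _<_ G D → Config.IsOrbit _<_ G E →
    Config.PrimitivePair _<_ G D S B →
    Config.IsBlock _<_ G E C →
    Config.Controls _<_ G C B S →
    Config.PrimitivePair _<_ G E C T →
    Config.Controls _<_ G T B S ⊎ Config.Controls _<_ G S T C
lemma5p12 _<_ _ _ G _ _ S B C T _ _ (_ , B-block , S⊆B , _ , B-primitive) _ C▶S (_ , _ , C⊆T , _ , _) =
  dichotomy (nonempty? S) (nonempty? C)
  where
  open Config _<_ G using (Controls)
  open Weaving _<_ G

  dichotomy : Dec (Nonempty S) → Dec (Nonempty C) → Controls T B S ⊎ Controls S T C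
  dichotomy (no S-empty) _ = ⊥-elim (C▶S (uniformlyWoven-emptyʳ {S = S} S-empty))
  dichotomy _ (no C-empty) = ⊥-elim (C▶S (uniformlyWoven-emptyˡ {S = S} C-empty))
  dichotomy (yes S≠∅) (yes C≠∅)
    with primitive⇒excludedMiddle {S = S} B-block S⊆B S≠∅ B-primitive {UniformlyWoven T B S}
  ... | no T-not-uniform = inj₁ T-not-uniform
  ... | yes T-uniform =
    inj₂ λ S-uniform → C▶S (uniformlyWoven-restrict C≠∅ S≠∅ C⊆T S⊆B T-uniform S-uniform)
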